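{- In the logic ERL$^*$, for every agent $a\in A$, all resources $s,t\in Res$ (with $s\cdot t$, resp. $t\cdot s$, defined in $Res$ where the composite resource $st$, resp. $ts$, occurs) and every formula $\phi$, the following hold, where $\psi_1\equiv\psi_2$ means that in every ERL$^*$ model every resource satisfies $\psi_1$ iff it satisfies $\psi_2$, and an implication $\psi_1\to\psi_2$ listed means that it is satisfied at every resource of every ERL$^*$ model: 1. $C_a^s(C_a^t\phi)\equiv C_a^{st}\phi$; 2. $D_a^s(D_a^t\phi)\to D_a^t\phi$; 3. $C_a^s\phi\to\widehat D_a^t(C_a^s\phi)$; 4. $D_a^t(\widehat C_a^s\phi)\to\widehat C_a^s\phi$; 5. $\widehat C_a^t(\widehat C_a^s\phi)\equiv\widehat C_a^{ts}\phi$; 6. $\widehat D_a^s\phi\to\widehat D_a^t(\widehat D_a^s\phi)$; 7. $C_a^e\phi\equiv\widehat D_a^e\phi$.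
   Context: Fix a finite set $A$ of agents, a finite set $Res$ of resources containing a distinguished element $e$ and equipped with a partial binary operation $\cdot$ (we write $st$ for $s\cdot t$), and a countable set $\mathrm{Prop}$ of atoms. Formulas: $\phi ::= p \mid \bot \mid \top \mid \neg\phi \mid I \mid \phi\vee\phi \mid \phi\wedge\phi \mid \phi\to\phi \mid \phi*\phi \mid \phi\mathbin{ -\!*}\phi \mid C_a^s\phi \mid D_a^s\phi$, with $a\in A$, $s\in Res$. A partial resource monoid is $(R,\bullet)$ with $Res\subseteq R$, $\bullet:R\times R\rightharpoonup R$ partial, such that for all $r_1,r_2,r_3\in R$: (i) if all lie in $Res$ then $r_1=r_2\cdot r_3$ iff $r_1=r_2\bullet r_3$; (ii) $r_1\bullet e$ is defined and equals $r_1$; (iii) if $r_1\bullet r_2$ is defined then $r_2\bullet r_1$ is defined and equal; (iv) if $r_1\bullet(r_2\bullet r_3)$ is defined then $(r_1\bullet r_2)\bullet r_3$ is defined and equal. An ERL model is $\mathcal M=((R,\bullet),\{\sim_a\}_{a\in A},V)$ with each $\sim_a$ an equivalence relation on $R$ and $V:\mathrm{Prop}\to\wp(R)$. An ERL$^*$ model is an ERL model additionally satisfying compatibility: for every agent $a$ and all $r,r',s\in R$, if $r\bullet s$ is defined and $r\sim_a r'$, then $r'\bullet s$ is defined and $r\bullet s\sim_a r'\bullet s$. Satisfaction: atoms via $V$; $\bot$ never, $\top$ always; $\neg,\vee,\wedge,\to$ classical; $r\models I$ iff $r=e$; $r\models\phi*\psi$ iff there are $r_1,r_2$ with $r_1\bullet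 r_2$ defined, $r_1\bullet r_2=r$, $r_1\models\phi$, $r_2\models\psi$; $r\models\phi\mathbin{ -\!*}\psi$ iff for all $r'$, if $r\bullet r'$ is defined and $r'\models\phi$ then $r\bullet r'\models\psi$; $r\models C_a^s\phi$ iff, if $r\bullet s$ is defined, then for all $r'$ with $r\bullet s\sim_a r'$, $r'\models\phi$; $r\models D_a^s\phi$ iff there is $r'$ with $r'\bullet s$ defined, $r\sim_a r'\bullet s$ and $r'\bullet s\models\phi$. Abbreviations: $\widehat C_a^s\phi:=\neg C_a^s\neg\phi$, $\widehat D_a^s\phi:=\neg D_a^s\neg\phi$. -}

module Defs where

open import Data.Nat using (ℕ)
open import Data.Fin using (Fin)
open import Data.Maybe using (Maybe; just)
open import Data.Product using (Σ; ∃; ∃-syntax; _×_; _,_)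
open import Data.Sum using (_⊎_)
open import Data.Empty using (⊥)
open import Data.Unit using (⊤)
open import Relation.Nullary using (¬_)
open import Relation.Binary.PropositionalEquality using (_≡_)
open import Relation.Binary.Structures using (IsEquivalence)
open import Function.Bundles using (_⇔_)

-- Fixed data: nA agents (Fin nA), nR resources Res = Fin nR,
-- distinguished e : Res, partial operation op on Res (Maybe-valued).
-- Atoms Prop = ℕ.

infixr 5 _⇒_

data Form (nA nR : ℕ) : Set where
  atom : ℕ → Form nA nR
  falsum verum : Form nA nR
  neg : Form nA nR → Form nA nR
  I : Form nA nR
  _∨f_ _∧f_ _⇒_ _✶_ _-✶_ : Form nA nR → Form nA nR → Form nA nR
  C D : Fin nA → Fin nR → Form nA nR → Form nA nR

Ĉ D̂ : ∀ {nA nR} → Fin nA → Fin nR → Form nA nR → Form nA nR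
Ĉ a s φ = neg (C a s (neg φ))
D̂ a s φ = neg (D a s (neg φ))

-- ERL model over (Res, e, op); Res ⊆ R is given by an injective map inj.
record ERLModel {nA nR : ℕ} (e : Fin nR) (op : Fin nR → Fin nR → Maybe (Fin nR)) : Set₁ where
  field
    R     : Set
    inj   : Fin nR → R
    inj-injective : ∀ s t → inj s ≡ inj t → s ≡ t
    _•_   : R → R → Maybe R
    res-op : ∀ (u s t : Fin nR) → (op s t ≡ just u) ⇔ (inj s • inj t ≡ just (inj u))
    unit  : ∀ r → r • inj e ≡ just r
    comm  : ∀ r₁ r₂ r → r₁ • r₂ ≡ just r → r₂ • r₁ ≡ just r
    assoc : ∀ r₁ r₂ r₃ r₂₃ r → r₂ • r₃ ≡ just r₂₃ → r₁ • r₂₃ ≡ just r →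
            ∃[ r₁₂ ] (r₁ • r₂ ≡ just r₁₂ × r₁₂ • r₃ ≡ just r)
    _∼[_]_ : R → Fin nA → R → Set
    ∼-equiv : ∀ a → IsEquivalence (λ x y → x ∼[ a ] y)
    V     : ℕ → R → Set

record ERL*Model {nA nR : ℕ} (e : Fin nR) (op : Fin nR → Fin nR → Maybe (Fin nR)) : Set₁ where
  field
    model : ERLModel {nA} e op
  open ERLModel model public
  field
    compat : ∀ a r r' s x → r • s ≡ just x → r ∼[ a ] r' →
             ∃[ y ] (r' • s ≡ just y × x ∼[ a ] y)

module _ {nA nR : ℕ} {e : Fin nR} {op : Fin nR → Fin nR → Maybe (Fin nR)}
         (M : ERLModel {nA} e op) where
  open ERLModel M

  _⊨_ : R → Form nA nR → Set
  r ⊨ atom p = V p r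
  r ⊨ falsum = ⊥
  r ⊨ verum = ⊤
  r ⊨ neg φ = ¬ (r ⊨ φ)
  r ⊨ I = r ≡ inj e
  r ⊨ (φ ∨f ψ) = (r ⊨ φ) ⊎ (r ⊨ ψ)
  r ⊨ (φ ∧f ψ) = (r ⊨ φ) × (r ⊨ ψ)
  r ⊨ (φ ⇒ ψ) = (r ⊨ φ) → (r ⊨ ψ)
  r ⊨ (φ ✶ ψ) = ∃[ r₁ ] ∃[ r₂ ] (r₁ • r₂ ≡ just r × r₁ ⊨ φ × r₂ ⊨ ψ)
  r ⊨ (φ -✶ ψ) = ∀ r' x → r • r' ≡ just x → r' ⊨ φ → x ⊨ ψ
  r ⊨ C a s φ = ∀ x → r • inj s ≡ just x → ∀ r' → x ∼[ a ] r' → r' ⊨ φ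
  r ⊨ D a s φ = ∃[ r' ] ∃[ x ] (r' • inj s ≡ just x × r ∼[ a ] x × x ⊨ φ)

ValidERL* : ∀ {nA nR} (e : Fin nR) (op : Fin nR → Fin nR → Maybe (Fin nR)) →
            Form nA nR → Set₁
ValidERL* e op ψ = ∀ (M : ERL*Model e op) (r : ERL*Model.R M) →
                   _⊨_ (ERL*Model.model M) r ψ

EquivERL* : ∀ {nA nR} (e : Fin nR) (op : Fin nR → Fin nR → Maybe (Fin nR)) →
            Form nA nR → Form nA nR → Set₁
EquivERL* e op ψ₁ ψ₂ = ∀ (M : ERL*Model e op) (r : ERL*Model.R M) →
                   _⊨_ (ERL*Model.model M) r ψ₁ ⇔ _⊨_ (ERL*Model.model M) r ψ₂

module Submission where

-- The seven items split into three groups, each following from one general fact.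
--
-- * Stability (items 2, 3, 4, 6).  Call a formula ψ  a-stable  when its truth is
--   invariant along ∼a.  Every D_a^s ψ is a-stable (since ∼a is an equivalence),
--   every C_a^s ψ is a-stable (this is where compatibility of ∼a with • is used),
--   and negations of a-stable formulas are a-stable.  A witness of D_a^t ψ is
--   ∼a-related to the point of evaluation, so for a-stable ψ we get D_a^t ψ → ψ,
--   and dually ψ → D̂_a^t ψ.  Items 2, 4 are the first law, items 3, 6 the second.
-- * Composition (items 1, 5).  C_a^s C_a^t φ ≡ C_a^{st} φ follows from
--   associativity of • and compatibility; item 5 is item 1 for ¬φ, after removing
--   a double negation under C_a^t (classical).
-- * Unit (item 7).  Since r • e = r, C_a^e is the box and D_a^e the diamond of ∼a,
--   so C_a^e φ ≡ ¬D_a^e ¬φ is the classical box/diamond duality.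

open import Defs
open import Level using (0ℓ)
open import Axiom.ExcludedMiddle using (ExcludedMiddle)
open import Axiom.DoubleNegationElimination using (em⇒dne)
open import Data.Nat using (ℕ)
open import Data.Fin using (Fin)
open import Data.Maybe using (Maybe; just)
open import Data.Maybe.Properties using (just-injective)
open import Data.Product using (_×_; _,_; ∃-syntax)
open import Relation.Binary.PropositionalEquality using (_≡_; refl; sym; trans; subst)
open import Relation.Binary.Structures using (IsEquivalence)
open import Function.Bundles using (_⇔_; mk⇔; Equivalence)
open import Function.Related.TypeIsomorphisms using (¬-cong-⇔)
import Function.Properties.Equivalence as ⇔

module Semantics {nA nR : ℕ} {e : Fin nR} {op : Fin nR → Fin nR → Maybe (Fin nR)}
                 (M : ERL*Model {nA} e op) where
  open ERL*Model M
  open Equivalence using (to; from)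

  _⊩_ : R → Form nA nR → Set
  _⊩_ = _⊨_ model

  ∼-refl : ∀ {a x} → x ∼[ a ] x
  ∼-refl {a} = IsEquivalence.refl (∼-equiv a)

  ∼-sym : ∀ {a x y} → x ∼[ a ] y → y ∼[ a ] x
  ∼-sym {a} = IsEquivalence.sym (∼-equiv a)

  ∼-trans : ∀ {a x y z} → x ∼[ a ] y → y ∼[ a ] z → x ∼[ a ] z
  ∼-trans {a} = IsEquivalence.trans (∼-equiv a)

  -- Needed to reassemble r (s t) from the stepwise updates r s and (r s) t.
  •-assoc-rebracket : ∀ {r₁ r₂ r₃ r₁₂ r₂₃ r} →
    r₁ • r₂ ≡ just r₁₂ → r₁₂ • r₃ ≡ just r → r₂ • r₃ ≡ just r₂₃ → r₁ • r₂₃ ≡ just r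
  •-assoc-rebracket {r₁} {r₂} {r₃} {r₁₂} {r₂₃} {r} p₁₂ p p₂₃
    with assoc r₃ r₂ r₁ r₁₂ r (comm r₁ r₂ r₁₂ p₁₂) (comm r₁₂ r₃ r p)
  ... | r₃₂ , p₃₂ , p₃₂-₁ with trans (sym p₃₂) (comm r₂ r₃ r₂₃ p₂₃)
  ... | refl = comm r₃₂ r₁ r p₃₂-₁

  Stable : Fin nA → Form nA nR → Set
  Stable a ψ = ∀ {r x} → r ∼[ a ] x → r ⊩ ψ → x ⊩ ψ

  ¬-stable : ∀ a ψ → Stable a ψ → Stable a (neg ψ)
  ¬-stable a ψ ψ-stable r∼x ¬ψ ψ-at-x = ¬ψ (ψ-stable (∼-sym r∼x) ψ-at-x)

  D-stable : ∀ a s ψ → Stable a (D a s ψ)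
  D-stable a s ψ r∼x (r' , y , p , r∼y , h) = r' , y , p , ∼-trans (∼-sym r∼x) r∼y , h

  -- C_a^s ψ is a-stable: by compatibility, r ∼a x moves x • s into the ∼a-class
  -- of r • s, and C_a^s ψ holds at r on that whole class.
  C-stable : ∀ a s ψ → Stable a (C a s ψ)
  C-stable a s ψ {r} {x} r∼x h y x•s z y∼z with compat a x r (inj s) y x•s (∼-sym r∼x)
  ... | y' , r•s , y∼y' = h y' r•s z (∼-trans (∼-sym y∼y') y∼z)

  -- A D_a^t-witness is ∼a-related to the point of evaluation, so D_a^t cannot
  -- create an a-stable property.
  D-reflect : ∀ a t ψ → Stable a ψ → ∀ r → r ⊩ (D a t ψ ⇒ ψ)
  D-reflect a t ψ ψ-stable r (r' , x , p , r∼x , h) = ψ-stable (∼-sym r∼x) h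

  D̂-intro : ∀ a t ψ → Stable a ψ → ∀ r → r ⊩ (ψ ⇒ D̂ a t ψ)
  D̂-intro a t ψ ψ-stable r h ¬ψ-witness =
    D-reflect a t (neg ψ) (¬-stable a ψ ψ-stable) r ¬ψ-witness h

  C-compose : ∀ a s t φ st → op s t ≡ just st →
              ∀ r → (r ⊩ C a s (C a t φ)) ⇔ (r ⊩ C a st φ)
  C-compose a s t φ st st-def r = mk⇔ split merge
    where
    st• : inj s • inj t ≡ just (inj st)
    st• = to (res-op st s t) st-def

    split : r ⊩ C a s (C a t φ) → r ⊩ C a st φ
    split h z r•st w z∼w with assoc r (inj s) (inj t) (inj st) z st• r•st
    ... | x , r•s , x•t = h x r•s x ∼-refl z x•t w z∼w

    merge : r ⊩ C a st φ → r ⊩ C a s (C a t φ)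
    merge h x r•s r' x∼r' y r'•t w y∼w with compat a r' x (inj t) y r'•t (∼-sym x∼r')
    ... | y' , x•t , y∼y' = h y' (•-assoc-rebracket r•s x•t st•) w (∼-trans (∼-sym y∼y') y∼w)

  C-cong : ∀ a s φ ψ → (∀ r → (r ⊩ φ) ⇔ (r ⊩ ψ)) → ∀ r → (r ⊩ C a s φ) ⇔ (r ⊩ C a s ψ)
  C-cong a s φ ψ φ⇔ψ r = mk⇔
    (λ h x p r' q → to (φ⇔ψ r') (h x p r' q))
    (λ h x p r' q → from (φ⇔ψ r') (h x p r' q))

  •e-identity : ∀ {r x} → r • inj e ≡ just x → r ≡ x
  •e-identity {r} r•e = just-injective (trans (sym (unit r)) r•e)

  C-unit : ∀ a φ r → (r ⊩ C a e φ) ⇔ (∀ r' → r ∼[ a ] r' → r' ⊩ φ)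
  C-unit a φ r = mk⇔ (λ h → h r (unit r))
    (λ h x r•e r' x∼r' → h r' (subst (λ y → y ∼[ a ] r') (sym (•e-identity r•e)) x∼r'))

  D-unit : ∀ a ψ r → (r ⊩ D a e ψ) ⇔ (∃[ r' ] (r ∼[ a ] r' × r' ⊩ ψ))
  D-unit a ψ r = mk⇔ (λ (_ , x , _ , r∼x , h) → x , r∼x , h)
                     (λ (r' , r∼r' , h) → r' , r' , unit r' , r∼r' , h)

  -- Items 5 and 7 remove double negations, which needs excluded middle.
  module Classical (em : ExcludedMiddle 0ℓ) where

    ¬¬-elim : ∀ r φ → (r ⊩ neg (neg φ)) ⇔ (r ⊩ φ)
    ¬¬-elim r φ = mk⇔ (em⇒dne em) (λ h ¬h → ¬h h)

    -- Item 5: item 1 for ¬φ, with the double negation ¬¬C_a^s¬φ under C_a^t removed.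
    Ĉ-compose : ∀ a s t φ ts → op t s ≡ just ts →
                ∀ r → (r ⊩ Ĉ a t (Ĉ a s φ)) ⇔ (r ⊩ Ĉ a ts φ)
    Ĉ-compose a s t φ ts ts-def r = ¬-cong-⇔ (⇔.trans
      (C-cong a t (neg (neg (C a s (neg φ)))) (C a s (neg φ)) (λ r' → ¬¬-elim r' (C a s (neg φ))) r)
      (C-compose a t s (neg φ) ts ts-def r))

    C-unit-dual : ∀ a φ r → (r ⊩ C a e φ) ⇔ (r ⊩ D̂ a e φ)
    C-unit-dual a φ r = mk⇔
      (λ h ¬φ-witness → let (r' , r∼r' , ¬φ) = to (D-unit a (neg φ) r) ¬φ-witness
                        in ¬φ (to (C-unit a φ r) h r' r∼r'))
      (λ h → from (C-unit a φ r) λ r' r∼r' →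
         em⇒dne em λ ¬φ → h (from (D-unit a (neg φ) r) (r' , r∼r' , ¬φ)))

lemma1 : ExcludedMiddle 0ℓ →
    ∀ (nA nR : ℕ) (e : Fin nR) (op : Fin nR → Fin nR → Maybe (Fin nR))
    (a : Fin nA) (s t : Fin nR) (φ : Form nA nR) →
    (∀ st → op s t ≡ just st → EquivERL* e op (C a s (C a t φ)) (C a st φ))
    × ValidERL* e op (D a s (D a t φ) ⇒ D a t φ)
    × ValidERL* e op (C a s φ ⇒ D̂ a t (C a s φ))
    × ValidERL* e op (D a t (Ĉ a s φ) ⇒ Ĉ a s φ)
    × (∀ ts → op t s ≡ just ts → EquivERL* e op (Ĉ a t (Ĉ a s φ)) (Ĉ a ts φ))
    × ValidERL* e op (D̂ a s φ ⇒ D̂ a t (D̂ a s φ))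
    × EquivERL* e op (C a e φ) (D̂ a e φ)
lemma1 em nA nR e op a s t φ =
    (λ st st-def M → C-compose M a s t φ st st-def)
  , (λ M → D-reflect M a s (D a t φ) (D-stable M a t φ))
  , (λ M → D̂-intro M a t (C a s φ) (C-stable M a s φ))
  , (λ M → D-reflect M a t (Ĉ a s φ) (¬-stable M a (C a s (neg φ)) (C-stable M a s (neg φ))))
  , (λ ts ts-def M → Classical.Ĉ-compose M em a s t φ ts ts-def)
  , (λ M → D̂-intro M a t (D̂ a s φ) (¬-stable M a (D a s (neg φ)) (D-stable M a s (neg φ))))
  , (λ M → Classical.C-unit-dual M em a φ)
  where open Semantics
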